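{- For every integer $d\ge 1$, $s\chi(d)\ge 2d$.
   Context: A graph $G=(V,E)$ is strongly $k$-colorable if for every collection $V_1,\dots,V_r$ of pairwise disjoint subsets of $V$, each of size at most $k$, the graph obtained from $G$ by adding all edges between distinct vertices within each $V_i$ is properly $k$-colorable. The strong chromatic number $s\chi(G)$ is the minimum $k$ such that $G$ is strongly $k$-colorable, and $s\chi(d)=\max s\chi(G)$ over all finite simple graphs $G$ of maximum degree at most $d$. -}

module Defs where

open import Data.Nat using (ℕ; _≤_; _<_; _*_; _≥_)
open import Data.Bool using (Bool; true; false)
open import Data.Fin using (Fin)
open import Data.Fin.Subset using (Subset; _∈_; ∣_∣)
open import Data.List using (List; length; filterᵇ; allFin)
open import Data.Product using (Σ; ∃; _×_)
open import Relation.Binary.PropositionalEquality using (_≡_; _≢_)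
open import Relation.Nullary using (¬_)

record Graph (n : ℕ) : Set where
  field
    adj   : Fin n → Fin n → Bool
    sym   : ∀ u v → adj u v ≡ adj v u
    irrefl : ∀ v → adj v v ≡ false
open Graph public

degree : ∀ {n} → Graph n → Fin n → ℕ
degree G v = length (filterᵇ (adj G v) (allFin _))

MaxDegreeAtMost : ∀ {n} → Graph n → ℕ → Set
MaxDegreeAtMost G d = ∀ v → degree G v ≤ d

record Blocks (n k : ℕ) : Set where
  field
    r        : ℕ
    block    : Fin r → Subset n
    disjoint : ∀ i j v → v ∈ block i → v ∈ block j → i ≡ j
    small    : ∀ i → ∣ block i ∣ ≤ k
open Blocks public

ProperColoringWithBlocks : ∀ {n k} → Graph n → Blocks n k → (Fin n → Fin k) → Set
ProperColoringWithBlocks G B c =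
  (∀ u v → adj G u v ≡ true → c u ≢ c v) ×
  (∀ i u v → u ≢ v → u ∈ block B i → v ∈ block B i → c u ≢ c v)

StronglyColorable : ∀ {n} → Graph n → ℕ → Set
StronglyColorable {n} G k =
  (B : Blocks n k) → Σ (Fin n → Fin k) (ProperColoringWithBlocks G B)

-- The complete bipartite graph K_{d,d} has maximum degree d. Given k < 2d with k ≥ 1, put
-- s = min(d, k) and take as the two blocks the first s vertices of each side. Adding the
-- block edges turns these 2s vertices into a clique (vertices on opposite sides are already
-- adjacent), and 2s > k, so by pigeonhole no k-colouring is proper. For k = 0 there is no
-- colouring at all.
module Submission where

open import Defs hiding (sym)
open import Data.Nat using (ℕ; _≤_; _<_; _*_; zero; suc; _+_; _⊓_; _<ᵇ_; z≤n; s≤s)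
open import Data.Nat.Properties
  using (≤-total; ≤-reflexive; ≤-trans; m≤m+n; m<m+n; +-identityʳ; m⊓n≤m; m⊓n≤n;
         m≤n⇒m⊓n≡m; m≥n⇒m⊓n≡n; <⇒<ᵇ)
open import Data.Bool using (Bool; true; false; _xor_; if_then_else_)
open import Data.Bool.Properties using (xor-comm; xor-same; T-≡; if-eta)
import Data.Fin as Fin
open import Data.Fin using (Fin; toℕ; fromℕ<; splitAt; join; inject≤)
open import Data.Fin.Properties
  using (pigeonhole; <⇒≢; toℕ<n; splitAt-join; join-splitAt; toℕ-inject≤; inject≤-injective)
open import Data.Fin.Subset using (Subset; _∈_; _∉_; ∣_∣)
open import Data.Fin.Subset.Properties using (∣⊥∣≡0; ∣⊤∣≡n)
open import Data.List using (filterᵇ; length)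
import Data.List as List
import Data.Vec as Vec
open import Data.Vec.Properties
  using (tabulate-cong; tabulate-allFin; map-const; lookup∘tabulate; []=⇒lookup; lookup⇒[]=)
open import Data.Product using (Σ; _×_; _,_; proj₁; uncurry)
open import Data.Sum using (_⊎_; inj₁; inj₂; [_,_]′)
import Data.Sum as Sum
open import Data.Sum.Properties using (inj₁-injective; inj₂-injective; [,]-map; [,]-∘)
open import Data.Empty using (⊥-elim)
open import Function using (_∘_; id; const; Equivalence)
open import Relation.Nullary using (¬_)
open import Relation.Binary.PropositionalEquality
  using (_≡_; _≢_; refl; sym; trans; cong; cong₂; subst; module ≡-Reasoning)

∈-tabulate⁻ : ∀ {n} (p : Fin n → Bool) v → v ∈ Vec.tabulate p → p v ≡ true
∈-tabulate⁻ p v v∈ = trans (sym (lookup∘tabulate p v)) ([]=⇒lookup v∈)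

∈-tabulate⁺ : ∀ {n} (p : Fin n → Bool) v → p v ≡ true → v ∈ Vec.tabulate p
∈-tabulate⁺ p v pv = lookup⇒[]= v _ (trans (lookup∘tabulate p v) pv)

length-filterᵇ-tabulate : ∀ {A : Set} {n} (p : A → Bool) (g : Fin n → A) →
  length (filterᵇ p (List.tabulate g)) ≡ ∣ Vec.tabulate (p ∘ g) ∣
length-filterᵇ-tabulate {n = zero}  p g = refl
length-filterᵇ-tabulate {n = suc n} p g with p (g Fin.zero)
... | true  = cong suc (length-filterᵇ-tabulate p (g ∘ Fin.suc))
... | false = length-filterᵇ-tabulate p (g ∘ Fin.suc)

∣tabulate-const∣ : ∀ n b → ∣ Vec.tabulate {n = n} (const b) ∣ ≡ (if b then n else 0)
∣tabulate-const∣ n b =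
  trans (cong ∣_∣ (trans (tabulate-allFin {n = n} (const b)) (map-const _ b))) (∣replicate∣ b)
  where
  ∣replicate∣ : ∀ b → ∣ Vec.replicate n b ∣ ≡ (if b then n else 0)
  ∣replicate∣ true  = ∣⊤∣≡n n
  ∣replicate∣ false = ∣⊥∣≡0 n

initialSegment : ∀ {n} → ℕ → Fin n → Bool
initialSegment s i = toℕ i <ᵇ s

∣tabulate-initialSegment∣ : ∀ {n} s → s ≤ n → ∣ Vec.tabulate {n = n} (initialSegment s) ∣ ≡ s
∣tabulate-initialSegment∣ {n} zero    _         = ∣tabulate-const∣ n false
∣tabulate-initialSegment∣     (suc s) (s≤s s≤n) = cong suc (∣tabulate-initialSegment∣ s s≤n)

initialSegment-inject≤ : ∀ {s m} (i : Fin s) .(s≤m : s ≤ m) →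
  initialSegment s (inject≤ i s≤m) ≡ true
initialSegment-inject≤ i s≤m =
  Equivalence.to T-≡ (<⇒<ᵇ (subst (_< _) (sym (toℕ-inject≤ i s≤m)) (toℕ<n i)))

tabulate-splitAt : ∀ {A : Set} m {n} (f : Fin m → A) (g : Fin n → A) →
  Vec.tabulate ([ f , g ]′ ∘ splitAt m) ≡ Vec.tabulate f Vec.++ Vec.tabulate g
tabulate-splitAt zero    f g = refl
tabulate-splitAt (suc m) f g = cong (f Fin.zero Vec.∷_)
  (trans (tabulate-cong (λ i → [,]-map (splitAt m i))) (tabulate-splitAt m (f ∘ Fin.suc) g))

∣p++q∣ : ∀ {m n} (p : Subset m) (q : Subset n) → ∣ p Vec.++ q ∣ ≡ ∣ p ∣ + ∣ q ∣
∣p++q∣ Vec.[]          q = refl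
∣p++q∣ (true  Vec.∷ p) q = cong suc (∣p++q∣ p q)
∣p++q∣ (false Vec.∷ p) q = ∣p++q∣ p q

∣tabulate-splitAt∣ : ∀ m {n} (f : Fin m → Bool) (g : Fin n → Bool) →
  ∣ Vec.tabulate ([ f , g ]′ ∘ splitAt m) ∣ ≡ ∣ Vec.tabulate f ∣ + ∣ Vec.tabulate g ∣
∣tabulate-splitAt∣ m f g =
  trans (cong ∣_∣ (tabulate-splitAt m f g)) (∣p++q∣ (Vec.tabulate f) (Vec.tabulate g))

isLeft : ∀ m {n} → Fin (m + n) → Bool
isLeft m = [ const true , const false ]′ ∘ splitAt m

isLeft-join : ∀ m n x → isLeft m (join m n x) ≡ [ const true , const false ]′ x
isLeft-join m n x = cong [ const true , const false ]′ (splitAt-join m n x)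

splitAt-injective : ∀ m {n} {i j : Fin (m + n)} → splitAt m i ≡ splitAt m j → i ≡ j
splitAt-injective m {n} {i} {j} e =
  trans (sym (join-splitAt m n i)) (trans (cong (join m n) e) (join-splitAt m n j))

completeBipartite : ∀ m n → Graph (m + n)
completeBipartite m n = record
  { adj    = λ u v → isLeft m u xor isLeft m v
  ; sym    = λ u v → xor-comm (isLeft m u) (isLeft m v)
  ; irrefl = λ v → xor-same (isLeft m v)
  }

degree-completeBipartite : ∀ m n v →
  degree (completeBipartite m n) v ≡ (if isLeft m v then n else m)
degree-completeBipartite m n v = begin
  degree (completeBipartite m n) v
    ≡⟨ length-filterᵇ-tabulate ((b xor_) ∘ isLeft m) id ⟩
  ∣ Vec.tabulate ((b xor_) ∘ isLeft m) ∣
    ≡⟨ cong ∣_∣ (tabulate-cong (λ w → [,]-∘ (b xor_) (splitAt m w))) ⟩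
  ∣ Vec.tabulate ([ const (b xor true) , const (b xor false) ]′ ∘ splitAt m) ∣
    ≡⟨ ∣tabulate-splitAt∣ m _ _ ⟩
  ∣ Vec.tabulate {n = m} (const (b xor true)) ∣ + ∣ Vec.tabulate {n = n} (const (b xor false)) ∣
    ≡⟨ cong₂ _+_ (∣tabulate-const∣ m _) (∣tabulate-const∣ n _) ⟩
  (if b xor true then m else 0) + (if b xor false then n else 0)
    ≡⟨ other-side b ⟩
  (if b then n else m) ∎
  where
  open ≡-Reasoning
  b = isLeft m v
  other-side : ∀ b → (if b xor true then m else 0) + (if b xor false then n else 0)
                     ≡ (if b then n else m)
  other-side true  = refl
  other-side false = +-identityʳ m

data AdjacentWithBlocks {n k} (G : Graph n) (B : Blocks n k) (u v : Fin n) : Set where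
  adjacent  : adj G u v ≡ true → AdjacentWithBlocks G B u v
  sameBlock : u ≢ v → ∀ i → u ∈ block B i → v ∈ block B i → AdjacentWithBlocks G B u v

proper⇒distinct : ∀ {n k} {G : Graph n} {B : Blocks n k} {c : Fin n → Fin k} →
  ProperColoringWithBlocks G B c → ∀ {u v} → AdjacentWithBlocks G B u v → c u ≢ c v
proper⇒distinct (properG , properB) (adjacent uv)           = properG _ _ uv
proper⇒distinct (properG , properB) (sameBlock u≢v i u∈ v∈) = properB i _ _ u≢v u∈ v∈

clique⇒¬proper : ∀ {m n k} {G : Graph n} {B : Blocks n k} (f : Fin m → Fin n) → k < m →
  (∀ {i j} → i ≢ j → AdjacentWithBlocks G B (f i) (f j)) →
  ∀ c → ¬ ProperColoringWithBlocks G B c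
clique⇒¬proper f k<m clique c proper with pigeonhole k<m (c ∘ f)
... | i , j , i<j , same = proper⇒distinct proper (clique (<⇒≢ i<j)) same

noBlocks : ∀ {n k} → Blocks n k
noBlocks = record { r = 0 ; block = λ () ; disjoint = λ () ; small = λ () }

¬StronglyColorable-0 : ∀ {n} (G : Graph n) → Fin n → ¬ StronglyColorable G 0
¬StronglyColorable-0 G v colorable with proj₁ (colorable noBlocks) v
... | ()

leftBlock : ∀ m {n} → ℕ → Subset (m + n)
leftBlock m s = Vec.tabulate ([ initialSegment s , const false ]′ ∘ splitAt m)

rightBlock : ∀ m {n} → ℕ → Subset (m + n)
rightBlock m t = Vec.tabulate ([ const false , initialSegment t ]′ ∘ splitAt m)

∣leftBlock∣ : ∀ {m n s} → s ≤ m → ∣ leftBlock m {n} s ∣ ≡ s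
∣leftBlock∣ {m} {n} {s} s≤m = trans (∣tabulate-splitAt∣ m _ _)
  (trans (cong₂ _+_ (∣tabulate-initialSegment∣ s s≤m) (∣tabulate-const∣ n false))
         (+-identityʳ s))

∣rightBlock∣ : ∀ {m n t} → t ≤ n → ∣ rightBlock m {n} t ∣ ≡ t
∣rightBlock∣ {m} {n} {t} t≤n = trans (∣tabulate-splitAt∣ m _ _)
  (cong₂ _+_ (∣tabulate-const∣ m false) (∣tabulate-initialSegment∣ t t≤n))

leftBlock-rightBlock-disjoint : ∀ m {n} s t v → v ∈ leftBlock m {n} s → v ∉ rightBlock m t
leftBlock-rightBlock-disjoint m s t v v∈left v∈right
  with splitAt m v | ∈-tabulate⁻ _ v v∈left | ∈-tabulate⁻ _ v v∈right
... | inj₁ _ | _  | ()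
... | inj₂ _ | () | _

sideBlocks : ∀ {m n k s t} → s ≤ m → t ≤ n → s ≤ k → t ≤ k → Blocks (m + n) k
sideBlocks {m} {n} {k} {s} {t} s≤m t≤n s≤k t≤k =
  record { r = 2 ; block = sides ; disjoint = sides-disjoint ; small = sides-small }
  where
  sides : Fin 2 → Subset (m + n)
  sides Fin.zero            = leftBlock m s
  sides (Fin.suc Fin.zero)  = rightBlock m t

  sides-disjoint : ∀ i j v → v ∈ sides i → v ∈ sides j → i ≡ j
  sides-disjoint Fin.zero           Fin.zero           v _ _ = refl
  sides-disjoint (Fin.suc Fin.zero) (Fin.suc Fin.zero) v _ _ = refl
  sides-disjoint Fin.zero           (Fin.suc Fin.zero) v v∈left v∈right =
    ⊥-elim (leftBlock-rightBlock-disjoint m s t v v∈left v∈right)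
  sides-disjoint (Fin.suc Fin.zero) Fin.zero           v v∈right v∈left =
    ⊥-elim (leftBlock-rightBlock-disjoint m s t v v∈left v∈right)

  sides-small : ∀ i → ∣ sides i ∣ ≤ k
  sides-small Fin.zero           = subst (_≤ k) (sym (∣leftBlock∣ {n = n} s≤m)) s≤k
  sides-small (Fin.suc Fin.zero) = subst (_≤ k) (sym (∣rightBlock∣ {m} t≤n)) t≤k

module _ {m n s t : ℕ} (s≤m : s ≤ m) (t≤n : t ≤ n) where

  injectSides : Fin s ⊎ Fin t → Fin m ⊎ Fin n
  injectSides = Sum.map (λ i → inject≤ i s≤m) (λ j → inject≤ j t≤n)

  injectSides-injective : ∀ x y → injectSides x ≡ injectSides y → x ≡ y
  injectSides-injective (inj₁ i) (inj₁ j) e =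
    cong inj₁ (inject≤-injective s≤m s≤m i j (inj₁-injective e))
  injectSides-injective (inj₂ i) (inj₂ j) e =
    cong inj₂ (inject≤-injective t≤n t≤n i j (inj₂-injective e))
  injectSides-injective (inj₁ _) (inj₂ _) ()
  injectSides-injective (inj₂ _) (inj₁ _) ()

  cliqueVertex : Fin s ⊎ Fin t → Fin (m + n)
  cliqueVertex = join m n ∘ injectSides

  cliqueVertex-injective : ∀ {x y} → cliqueVertex x ≡ cliqueVertex y → x ≡ y
  cliqueVertex-injective {x} {y} eq = injectSides-injective x y (begin
    injectSides x                      ≡⟨ splitAt-join m n (injectSides x) ⟨
    splitAt m (cliqueVertex x)         ≡⟨ cong (splitAt m) eq ⟩
    splitAt m (cliqueVertex y)         ≡⟨ splitAt-join m n (injectSides y) ⟩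
    injectSides y                      ∎)
    where open ≡-Reasoning

  cliqueVertex∈leftBlock : ∀ i → cliqueVertex (inj₁ i) ∈ leftBlock m {n} s
  cliqueVertex∈leftBlock i = ∈-tabulate⁺ _ _
    (trans (cong [ initialSegment s , const false ]′ (splitAt-join m n (injectSides (inj₁ i))))
           (initialSegment-inject≤ i s≤m))

  cliqueVertex∈rightBlock : ∀ j → cliqueVertex (inj₂ j) ∈ rightBlock m {n} t
  cliqueVertex∈rightBlock j = ∈-tabulate⁺ _ _
    (trans (cong [ const false , initialSegment t ]′ (splitAt-join m n (injectSides (inj₂ j))))
           (initialSegment-inject≤ j t≤n))

  cliqueVertex-adjacent : ∀ {k} (s≤k : s ≤ k) (t≤k : t ≤ k) {x y} → x ≢ y →
    AdjacentWithBlocks (completeBipartite m n) (sideBlocks s≤m t≤n s≤k t≤k)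
                       (cliqueVertex x) (cliqueVertex y)
  cliqueVertex-adjacent _ _ {inj₁ i} {inj₁ j} x≢y =
    sameBlock (x≢y ∘ cliqueVertex-injective) Fin.zero
              (cliqueVertex∈leftBlock i) (cliqueVertex∈leftBlock j)
  cliqueVertex-adjacent _ _ {inj₂ i} {inj₂ j} x≢y =
    sameBlock (x≢y ∘ cliqueVertex-injective) (Fin.suc Fin.zero)
              (cliqueVertex∈rightBlock i) (cliqueVertex∈rightBlock j)
  cliqueVertex-adjacent _ _ {x@(inj₁ _)} {y@(inj₂ _)} _ =
    adjacent (cong₂ _xor_ (isLeft-join m n (injectSides x)) (isLeft-join m n (injectSides y)))
  cliqueVertex-adjacent _ _ {x@(inj₂ _)} {y@(inj₁ _)} _ =
    adjacent (cong₂ _xor_ (isLeft-join m n (injectSides x)) (isLeft-join m n (injectSides y)))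

completeBipartite-¬StronglyColorable : ∀ {m n k s t} →
  s ≤ m → t ≤ n → s ≤ k → t ≤ k → k < s + t → ¬ StronglyColorable (completeBipartite m n) k
completeBipartite-¬StronglyColorable {s = s} s≤m t≤n s≤k t≤k k<s+t colorable =
  uncurry (clique⇒¬proper (cliqueVertex s≤m t≤n ∘ splitAt s) k<s+t
             (λ i≢j → cliqueVertex-adjacent s≤m t≤n s≤k t≤k (i≢j ∘ splitAt-injective s)))
          (colorable (sideBlocks s≤m t≤n s≤k t≤k))

k<d⊓k+d⊓k : ∀ d {k} → 1 ≤ k → k < 2 * d → k < d ⊓ k + d ⊓ k
k<d⊓k+d⊓k d {k} 1≤k k<2d with ≤-total k d
... | inj₁ k≤d rewrite m≥n⇒m⊓n≡n k≤d = m<m+n k 1≤k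
... | inj₂ d≤k rewrite m≤n⇒m⊓n≡m d≤k | +-identityʳ d = k<2d

theorem10 : (d : ℕ) → 1 ≤ d →
    Σ ℕ (λ n → Σ (Graph n) (λ G →
      MaxDegreeAtMost G d × ((k : ℕ) → k < 2 * d → ¬ StronglyColorable G k)))
theorem10 d 1≤d = d + d , completeBipartite d d , regular , notStronglyColorable
  where
  regular : MaxDegreeAtMost (completeBipartite d d) d
  regular v = ≤-reflexive (trans (degree-completeBipartite d d v) (if-eta (isLeft d v)))

  notStronglyColorable : (k : ℕ) → k < 2 * d → ¬ StronglyColorable (completeBipartite d d) k
  notStronglyColorable zero _ =
    ¬StronglyColorable-0 (completeBipartite d d) (fromℕ< (≤-trans 1≤d (m≤m+n d d)))
  notStronglyColorable k@(suc _) k<2d = completeBipartite-¬StronglyColorable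
    (m⊓n≤m d k) (m⊓n≤m d k) (m⊓n≤n d k) (m⊓n≤n d k) (k<d⊓k+d⊓k d (s≤s z≤n) k<2d)
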